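{- For every finite simple graph $G$ with maximum degree $\Delta(G)$, the total game chromatic number satisfies $\chi''_g(G)\leq 2\Delta(G)+1$.
   Context: Total graph coloring game on a graph $G$ with a set $C$ of colors: two players, Alice and Bob, alternately color uncolored vertices and edges of $G$ with colors from $C$, Alice moving first. At every moment the partial coloring must be proper: any two incident objects (two adjacent vertices, a vertex and an edge containing it, or two edges sharing an endpoint) receive different colors. Alice wins if the whole graph (all vertices and all edges) eventually gets colored; Bob wins otherwise (i.e. if at some point an uncolored object cannot be legally colored). The total game chromatic number $\chi''_g(G)$ is the least $|C|$ for which Alice has a winning strategy. -}

module Defs where

open import Data.Nat using (ℕ; zero; suc; _⊔_)
open import Data.Fin using (Fin; _≟_)
open import Data.Bool using (Bool; true; false; if_then_else_)
open import Data.Maybe using (Maybe; just; nothing)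
open import Data.List using (List; length; filter; map; foldr; allFin)
open import Data.Product using (Σ; _×_; _,_)
open import Data.Sum using (_⊎_)
open import Data.Empty using (⊥)
open import Relation.Nullary using (¬_; does)
open import Relation.Nullary.Decidable using (⌊_⌋)
open import Data.Bool using (_∧_; _∨_; T?)
open import Relation.Binary.PropositionalEquality using (_≡_; _≢_)

record SimpleGraph (n : ℕ) : Set where
  field
    adj    : Fin n → Fin n → Bool
    sym    : ∀ i j → adj i j ≡ adj j i
    irrefl : ∀ i → adj i i ≡ false

module _ {n : ℕ} (G : SimpleGraph n) where
  open SimpleGraph G

  Adj : Fin n → Fin n → Set
  Adj i j = adj i j ≡ true

  degree : Fin n → ℕ
  degree i = length (filter (λ j → T? (adj i j)) (allFin n))

  maxDegree : ℕ
  maxDegree = foldr _⊔_ 0 (map degree (allFin n))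

  -- A partial total colouring with colours Fin k.
  -- vc i   : colour of vertex i (nothing = uncoloured)
  -- ec i j : colour of the edge {i,j} (stored symmetrically at (i,j) and (j,i);
  --          only meaningful when Adj i j)
  record State (k : ℕ) : Set where
    constructor mkState
    field
      vc : Fin n → Maybe (Fin k)
      ec : Fin n → Fin n → Maybe (Fin k)
  open State public

  initial : ∀ {k} → State k
  initial = mkState (λ _ → nothing) (λ _ _ → nothing)

  setV : ∀ {k} → State k → Fin n → Fin k → State k
  setV s i a = mkState (λ x → if ⌊ x ≟ i ⌋ then just a else vc s x) (ec s)

  setE : ∀ {k} → State k → Fin n → Fin n → Fin k → State k
  setE s i j a = mkState (vc s)
    (λ x y → if (⌊ x ≟ i ⌋ ∧ ⌊ y ≟ j ⌋) ∨ (⌊ x ≟ j ⌋ ∧ ⌊ y ≟ i ⌋)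
             then just a else ec s x y)

  record Proper {k : ℕ} (s : State k) : Set where
    field
      vv : ∀ i j a → Adj i j → vc s i ≡ just a → vc s j ≡ just a → ⊥
      ve : ∀ i j a → Adj i j → ec s i j ≡ just a → vc s i ≡ just a → ⊥
      ee : ∀ i j l a → Adj i j → Adj i l → j ≢ l →
           ec s i j ≡ just a → ec s i l ≡ just a → ⊥

  Complete : ∀ {k} → State k → Set
  Complete s = (∀ i → vc s i ≢ nothing) × (∀ i j → Adj i j → ec s i j ≢ nothing)

  LegalV : ∀ {k} → State k → Fin n → Fin k → Set
  LegalV s i a = vc s i ≡ nothing × Proper (setV s i a)

  LegalE : ∀ {k} → State k → Fin n → Fin n → Fin k → Set
  LegalE s i j a = Adj i j × ec s i j ≡ nothing × Proper (setE s i j a)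

  SomeLegalMove : ∀ {k} → State k → Set
  SomeLegalMove {k} s =
    Σ (Fin n) (λ i → Σ (Fin k) (λ a → LegalV s i a))
    ⊎ Σ (Fin n) (λ i → Σ (Fin n) (λ j → Σ (Fin k) (λ a → LegalE s i j a)))

  -- Positions from which Alice has a winning strategy (the game is finite,
  -- so winning strategies are exactly well-founded trees of this form).
  -- Alice wins iff the whole graph gets coloured; a stuck, incomplete position
  -- is a win for Bob (no constructor applies).
  mutual
    data AliceTurnWin {k : ℕ} : State k → Set where
      a-done  : ∀ {s} → Complete s → AliceTurnWin s
      a-moveV : ∀ {s} i a → LegalV s i a → BobTurnWin (setV s i a) → AliceTurnWin s
      a-moveE : ∀ {s} i j a → LegalE s i j a → BobTurnWin (setE s i j a) → AliceTurnWin s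

    data BobTurnWin {k : ℕ} : State k → Set where
      b-done : ∀ {s} → Complete s → BobTurnWin s
      b-move : ∀ {s} → SomeLegalMove s →
               (∀ i a → LegalV s i a → AliceTurnWin (setV s i a)) →
               (∀ i j a → LegalE s i j a → AliceTurnWin (setE s i j a)) →
               BobTurnWin s

  AliceWins : ℕ → Set
  AliceWins k = AliceTurnWin (initial {k})

  TotalGameChromatic≤ : ℕ → Set
  TotalGameChromatic≤ m = Σ ℕ (λ k → k Data.Nat.≤ m × AliceWins k)

module Submission where

-- Idea: with at least 2Δ + 1 colours no position of the total colouring game
-- is ever stuck, so Alice wins whatever either player does.  An uncoloured
-- vertex i sees at most 2Δ colours (its ≤ Δ neighbours and ≤ Δ incident
-- edges); an uncoloured edge ij sees at most 2 + 2(Δ - 1) = 2Δ colours (its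
-- two ends and the other ≤ Δ - 1 edges at each end).  Fewer than k forbidden
-- colours leave a free colour in Fin k, and that colour is a legal move.

open import Defs
open import Data.Nat using (ℕ; zero; suc; _+_; _*_; _⊔_; _≤_; _<_; z≤n; s≤s)
open import Data.Nat.Properties
  using (≤-refl; ≤-trans; <-≤-trans; ≤-pred; n<1+n; m≤n⇒m≤1+n; +-mono-≤; +-mono-<-≤; +-mono-≤-<;
         +-suc; +-identityʳ; m≤m⊔n; m≤n⊔m; module ≤-Reasoning)
open import Data.Fin as F using (Fin; _≟_)
open import Data.Fin.Properties using (any?; pigeonhole; ¬∀⟶∃¬; <-irrefl)
open import Data.Bool using (true; T; T?)
open import Data.Bool.Properties using () renaming (_≟_ to _≟ᵇ_)
open import Data.List using (List; []; _∷_; length; _++_; map; filter; allFin; lookup; foldr; catMaybes)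
open import Data.List.Properties using (length-++; length-map; length-catMaybes; catMaybes-++; Any-catMaybes⁺)
open import Data.List.Membership.Propositional using (_∈_; _∉_)
open import Data.List.Membership.Propositional.Properties using (∈-map⁺; ∈-filter⁺; ∈-allFin; ∈-++⁺ˡ; ∈-++⁺ʳ)
open import Data.List.Relation.Unary.Any as Any using (here; there)
open import Data.List.Relation.Unary.Any.Properties using (lookup-index)
open import Data.Maybe using (Maybe; just; nothing)
open import Data.Maybe.Properties using (just-injective; ≡-dec)
import Data.Maybe.Relation.Unary.Any as MaybeAny
open import Data.Product using (∃; _×_; _,_; proj₁; proj₂)
open import Data.Sum using (_⊎_; inj₁; inj₂; [_,_])
open import Data.Empty using (⊥; ⊥-elim)
open import Data.Unit using (tt)
open import Function using (_∘_)
open import Relation.Nullary using (¬_; yes; no)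
open import Relation.Nullary.Decidable using (_×-dec_)
open import Relation.Binary.PropositionalEquality using (_≡_; _≢_; refl; sym; trans; cong; cong₂; subst)

missingColour : ∀ {k} (xs : List (Fin k)) → length xs < k → ∃ λ a → a ∉ xs
missingColour {k} xs short = ¬∀⟶∃¬ k (_∈ xs) (λ a → Any.any? (a ≟_) xs) notAll
  where
  notAll : ¬ (∀ a → a ∈ xs)
  notAll covers with pigeonhole short (Any.index ∘ covers)
  ... | a , b , a<b , sameIndex = <-irrefl a≡b a<b
    where
    a≡b : a ≡ b
    a≡b = trans (lookup-index (covers a))
            (trans (cong (lookup xs) sameIndex) (sym (lookup-index (covers b))))

∈-catMaybes : ∀ {A : Set} {a : A} (xs : List (Maybe A)) → just a ∈ xs → a ∈ catMaybes xs
∈-catMaybes _ = Any-catMaybes⁺ ∘ Any.map λ { refl → MaybeAny.just refl }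

length-catMaybes-< : ∀ {A : Set} (xs : List (Maybe A)) → nothing ∈ xs →
                     length (catMaybes xs) < length xs
length-catMaybes-< (just _ ∷ xs)  (there p)   = s≤s (length-catMaybes-< xs p)
length-catMaybes-< (nothing ∷ xs) (here refl) = s≤s (length-catMaybes xs)
length-catMaybes-< (nothing ∷ xs) (there p)   = m≤n⇒m≤1+n (length-catMaybes-< xs p)

length-catMaybes-++ : ∀ {A : Set} (xs ys : List (Maybe A)) →
                      length (catMaybes (xs ++ ys)) ≤ length xs + length (catMaybes ys)
length-catMaybes-++ xs ys = begin
  length (catMaybes (xs ++ ys))                ≡⟨ cong length (catMaybes-++ xs ys) ⟩
  length (catMaybes xs ++ catMaybes ys)        ≡⟨ length-++ (catMaybes xs) ⟩
  length (catMaybes xs) + length (catMaybes ys) ≤⟨ +-mono-≤ (length-catMaybes xs) ≤-refl ⟩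
  length xs + length (catMaybes ys)            ∎
  where open ≤-Reasoning

≤-maximum : ∀ {x} (xs : List ℕ) → x ∈ xs → x ≤ foldr _⊔_ 0 xs
≤-maximum (y ∷ ys) (here refl) = m≤m⊔n y _
≤-maximum (y ∷ ys) (there p)   = ≤-trans (≤-maximum ys p) (m≤n⊔m y _)

∑ : ∀ {n} → (Fin n → ℕ) → ℕ
∑ {zero}  f = 0
∑ {suc n} f = f F.zero + ∑ (f ∘ F.suc)

∑-mono : ∀ {n} (f g : Fin n → ℕ) → (∀ x → f x ≤ g x) → ∑ f ≤ ∑ g
∑-mono {zero}  f g f≤g = z≤n
∑-mono {suc n} f g f≤g = +-mono-≤ (f≤g F.zero) (∑-mono _ _ (f≤g ∘ F.suc))

∑-strict : ∀ {n} (f g : Fin n → ℕ) → (∀ x → f x ≤ g x) → ∀ x₀ → f x₀ < g x₀ → ∑ f < ∑ g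
∑-strict {suc n} f g f≤g F.zero     f<g = +-mono-<-≤ f<g (∑-mono _ _ (f≤g ∘ F.suc))
∑-strict {suc n} f g f≤g (F.suc x₀) f<g =
  +-mono-≤-< (f≤g F.zero) (∑-strict _ _ (f≤g ∘ F.suc) x₀ f<g)

module GraphFacts {n : ℕ} (G : SimpleGraph n) where
  open SimpleGraph G using (adj; irrefl)

  Δ : ℕ
  Δ = maxDegree G

  neighbours : Fin n → List (Fin n)
  neighbours i = filter (λ j → T? (adj i j)) (allFin n)

  ∈-neighbours : ∀ {i j} → Adj G i j → j ∈ neighbours i
  ∈-neighbours {i} {j} i~j =
    ∈-filter⁺ (λ l → T? (adj i l)) (∈-allFin j) (subst T (sym i~j) tt)

  |neighbours|≤Δ : ∀ i → length (neighbours i) ≤ Δ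
  |neighbours|≤Δ i = ≤-maximum (map (degree G) (allFin n)) (∈-map⁺ (degree G) (∈-allFin i))

  adj-irrefl : ∀ {i} → ¬ Adj G i i
  adj-irrefl {i} i~i with trans (sym (irrefl i)) i~i
  ... | ()

  adj-sym : ∀ {i j} → Adj G i j → Adj G j i
  adj-sym {i} {j} = trans (SimpleGraph.sym G j i)

module Positions {n : ℕ} (G : SimpleGraph n) {k : ℕ} where

  Position : Set
  Position = State G k

  Symmetric : Position → Set
  Symmetric s = ∀ x y → ec s x y ≡ ec s y x

  OnEdge : Fin n → Fin n → Fin n → Fin n → Set
  OnEdge i j x y = (x ≡ i × y ≡ j) ⊎ (x ≡ j × y ≡ i)

  onEdge-swap : ∀ {i j x y} → OnEdge i j x y → OnEdge i j y x
  onEdge-swap (inj₁ (x≡i , y≡j)) = inj₂ (y≡j , x≡i)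
  onEdge-swap (inj₂ (x≡j , y≡i)) = inj₁ (y≡i , x≡j)

  onEdge-functional : ∀ {i j x y l} → OnEdge i j x y → OnEdge i j x l → y ≡ l
  onEdge-functional (inj₁ (refl , refl)) (inj₁ (_ , refl))    = refl
  onEdge-functional (inj₁ (refl , refl)) (inj₂ (refl , refl)) = refl
  onEdge-functional (inj₂ (refl , refl)) (inj₁ (refl , refl)) = refl
  onEdge-functional (inj₂ (refl , refl)) (inj₂ (_ , refl))    = refl

  setV-view : ∀ (s : Position) i a x →
    (x ≡ i × vc (setV G s i a) x ≡ just a) ⊎ (x ≢ i × vc (setV G s i a) x ≡ vc s x)
  setV-view s i a x with x ≟ i
  ... | yes x≡i = inj₁ (x≡i , refl)
  ... | no  x≢i = inj₂ (x≢i , refl)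

  setE-view : ∀ (s : Position) i j a x y →
    (OnEdge i j x y × ec (setE G s i j a) x y ≡ just a) ⊎
    (¬ OnEdge i j x y × ec (setE G s i j a) x y ≡ ec s x y)
  setE-view s i j a x y with x ≟ i | y ≟ j | x ≟ j | y ≟ i
  ... | yes x≡i | yes y≡j | _       | _       = inj₁ (inj₁ (x≡i , y≡j) , refl)
  ... | yes _   | no  y≢j | yes x≡j | yes y≡i = inj₁ (inj₂ (x≡j , y≡i) , refl)
  ... | yes _   | no  y≢j | yes _   | no  y≢i = inj₂ ([ y≢j ∘ proj₂ , y≢i ∘ proj₂ ] , refl)
  ... | yes _   | no  y≢j | no  x≢j | _       = inj₂ ([ y≢j ∘ proj₂ , x≢j ∘ proj₁ ] , refl)
  ... | no  x≢i | _       | yes x≡j | yes y≡i = inj₁ (inj₂ (x≡j , y≡i) , refl)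
  ... | no  x≢i | _       | yes _   | no  y≢i = inj₂ ([ x≢i ∘ proj₁ , y≢i ∘ proj₂ ] , refl)
  ... | no  x≢i | _       | no  x≢j | _       = inj₂ ([ x≢i ∘ proj₁ , x≢j ∘ proj₁ ] , refl)

  setE-symmetric : ∀ (s : Position) i j a → Symmetric s → Symmetric (setE G s i j a)
  setE-symmetric s i j a sym-s x y with setE-view s i j a x y | setE-view s i j a y x
  ... | inj₁ (_ , e₁)     | inj₁ (_ , e₂)     = trans e₁ (sym e₂)
  ... | inj₁ (on , _)     | inj₂ (off , _)    = ⊥-elim (off (onEdge-swap on))
  ... | inj₂ (off , _)    | inj₁ (on , _)     = ⊥-elim (off (onEdge-swap on))
  ... | inj₂ (_ , e₁)     | inj₂ (_ , e₂)     = trans e₁ (trans (sym-s x y) (sym e₂))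

  Uncoloured : Position → Set
  Uncoloured s = (∃ λ i → vc s i ≡ nothing) ⊎ (∃ λ i → ∃ λ j → Adj G i j × ec s i j ≡ nothing)

  -- Completeness is decidable, since all quantifiers range over Fin n.
  complete-or-uncoloured : ∀ s → Complete G s ⊎ Uncoloured s
  complete-or-uncoloured s
    with any? (λ i → ≡-dec _≟_ (vc s i) nothing)
       | any? (λ i → any? (λ j → (SimpleGraph.adj G i j ≟ᵇ true) ×-dec ≡-dec _≟_ (ec s i j) nothing))
  ... | yes v | _     = inj₂ (inj₁ v)
  ... | no  _ | yes e = inj₂ (inj₂ e)
  ... | no ¬v | no ¬e = inj₁ ((λ i e → ¬v (i , e)) , (λ i j i~j e → ¬e (i , j , i~j , e)))

  -- Termination measure: uncoloured vertices plus ordered pairs (x , y) with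
  -- no stored edge colour.  Every legal move strictly lowers it.
  blank : Maybe (Fin k) → ℕ
  blank nothing  = 1
  blank (just _) = 0

  uncoloured : Position → ℕ
  uncoloured s = ∑ (λ x → blank (vc s x)) + ∑ (λ x → ∑ (λ y → blank (ec s x y)))

  setV-decreases : ∀ (s : Position) i a → vc s i ≡ nothing → uncoloured (setV G s i a) < uncoloured s
  setV-decreases s i a blank-i = +-mono-<-≤ (∑-strict _ _ fewer i strictly) ≤-refl
    where
    fewer : ∀ x → blank (vc (setV G s i a) x) ≤ blank (vc s x)
    fewer x with setV-view s i a x
    ... | inj₁ (_ , e) rewrite e = z≤n
    ... | inj₂ (_ , e) rewrite e = ≤-refl
    strictly : blank (vc (setV G s i a) i) < blank (vc s i)
    strictly with setV-view s i a i
    ... | inj₁ (_ , e)   rewrite e | blank-i = s≤s z≤n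
    ... | inj₂ (i≢i , _) = ⊥-elim (i≢i refl)

  setE-decreases : ∀ (s : Position) i j a → ec s i j ≡ nothing → uncoloured (setE G s i j a) < uncoloured s
  setE-decreases s i j a blank-ij =
    +-mono-≤-< ≤-refl (∑-strict _ _ (λ x → ∑-mono _ _ (fewer x)) i (∑-strict _ _ (fewer i) j strictly))
    where
    fewer : ∀ x y → blank (ec (setE G s i j a) x y) ≤ blank (ec s x y)
    fewer x y with setE-view s i j a x y
    ... | inj₁ (_ , e) rewrite e = z≤n
    ... | inj₂ (_ , e) rewrite e = ≤-refl
    strictly : blank (ec (setE G s i j a) i j) < blank (ec s i j)
    strictly with setE-view s i j a i j
    ... | inj₁ (_ , e)   rewrite e | blank-ij = s≤s z≤n
    ... | inj₂ (off , _) = ⊥-elim (off (inj₁ (refl , refl)))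

-- Let `Good` be an invariant preserved by all legal moves under which every
-- position is complete or admits a legal move.  Then from every good
-- position both Alice-to-move and Bob-to-move are wins for Alice: the game
-- ends after finitely many moves and can only end with a complete colouring.
module NeverStuck {n : ℕ} (G : SimpleGraph n) {k : ℕ} (Good : State G k → Set)
  (goodV : ∀ {s} i a → Good s → LegalV G s i a → Good (setV G s i a))
  (goodE : ∀ {s} i j a → Good s → LegalE G s i j a → Good (setE G s i j a))
  (progress : ∀ s → Good s → Complete G s ⊎ SomeLegalMove G s) where
  open Positions G {k}

  wins : ∀ bound s → uncoloured s < bound → Good s → AliceTurnWin G s × BobTurnWin G s
  wins (suc bound) s fewer good with progress s good
  ... | inj₁ done = a-done done , b-done done
  ... | inj₂ move = aliceMoves move , b-move move afterV afterE
    where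
    winsAfterV : ∀ i a → LegalV G s i a → AliceTurnWin G (setV G s i a) × BobTurnWin G (setV G s i a)
    winsAfterV i a legal@(blank-i , _) =
      wins bound _ (<-≤-trans (setV-decreases s i a blank-i) (≤-pred fewer)) (goodV i a good legal)

    winsAfterE : ∀ i j a → LegalE G s i j a → AliceTurnWin G (setE G s i j a) × BobTurnWin G (setE G s i j a)
    winsAfterE i j a legal@(_ , blank-ij , _) =
      wins bound _ (<-≤-trans (setE-decreases s i j a blank-ij) (≤-pred fewer)) (goodE i j a good legal)

    afterV : ∀ i a → LegalV G s i a → AliceTurnWin G (setV G s i a)
    afterV i a legal = proj₁ (winsAfterV i a legal)

    afterE : ∀ i j a → LegalE G s i j a → AliceTurnWin G (setE G s i j a)
    afterE i j a legal = proj₁ (winsAfterE i j a legal)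

    aliceMoves : SomeLegalMove G s → AliceTurnWin G s
    aliceMoves (inj₁ (i , a , legal))     = a-moveV i a legal (proj₂ (winsAfterV i a legal))
    aliceMoves (inj₂ (i , j , a , legal)) = a-moveE i j a legal (proj₂ (winsAfterE i j a legal))

  aliceWinsFrom : ∀ s → Good s → AliceTurnWin G s
  aliceWinsFrom s good = proj₁ (wins (suc (uncoloured s)) s ≤-refl good)

module FreeColours {n : ℕ} (G : SimpleGraph n) {k : ℕ} (enough : 2 * GraphFacts.Δ G < k) where
  open GraphFacts G
  open Positions G {k}

  ∈-map-neighbours : ∀ {A : Set} (f : Fin n → Maybe A) {i y a} → Adj G i y → f y ≡ just a →
                     just a ∈ map f (neighbours i)
  ∈-map-neighbours f i~y fy≡a = subst (_∈ map f _) fy≡a (∈-map⁺ f (∈-neighbours i~y))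

  sameColour : ∀ {m : Maybe (Fin k)} {a b} → m ≡ just a → m ≡ just b → a ≡ b
  sameColour e₁ e₂ = just-injective (trans (sym e₁) e₂)

  twoΔ<k : ∀ {p q} → p ≤ Δ → q ≤ Δ → p + q < k
  twoΔ<k {p} {q} p≤Δ q≤Δ = begin-strict
    p + q     ≤⟨ +-mono-≤ p≤Δ q≤Δ ⟩
    Δ + Δ     ≡⟨ cong (Δ +_) (sym (+-identityʳ Δ)) ⟩
    2 * Δ     <⟨ enough ⟩
    k         ∎
    where open ≤-Reasoning

  -- The (possibly missing) colours of the neighbours and incident edges of i;
  -- the colours present among them are exactly those forbidden at i.
  coloursAroundVertex : Position → Fin n → List (Maybe (Fin k))
  coloursAroundVertex s i = map (vc s) (neighbours i) ++ map (ec s i) (neighbours i)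

  vertexConflicts : Position → Fin n → List (Fin k)
  vertexConflicts s i = catMaybes (coloursAroundVertex s i)

  |vertexConflicts|<k : ∀ s i → length (vertexConflicts s i) < k
  |vertexConflicts|<k s i = ≤-trans (s≤s (begin
    length (vertexConflicts s i)                            ≤⟨ length-catMaybes (Nᵥ ++ Nₑ) ⟩
    length (Nᵥ ++ Nₑ)                                       ≡⟨ length-++ Nᵥ ⟩
    length Nᵥ + length Nₑ                                   ≡⟨ cong₂ _+_ (length-map (vc s) (neighbours i)) (length-map (ec s i) (neighbours i)) ⟩
    length (neighbours i) + length (neighbours i)           ∎))
    (twoΔ<k (|neighbours|≤Δ i) (|neighbours|≤Δ i))
    where
    open ≤-Reasoning
    Nᵥ = map (vc s) (neighbours i)
    Nₑ = map (ec s i) (neighbours i)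

  neighbour-conflict : ∀ s {i y a} → Adj G i y → vc s y ≡ just a → a ∈ vertexConflicts s i
  neighbour-conflict s {i} i~y e = ∈-catMaybes (coloursAroundVertex s i) (∈-++⁺ˡ (∈-map-neighbours (vc s) i~y e))

  incident-conflict : ∀ s {i y a} → Adj G i y → ec s i y ≡ just a → a ∈ vertexConflicts s i
  incident-conflict s {i} i~y e =
    ∈-catMaybes (coloursAroundVertex s i) (∈-++⁺ʳ (map (vc s) (neighbours i)) (∈-map-neighbours (ec s i) i~y e))

  setV-proper : ∀ s i a → Proper G s → a ∉ vertexConflicts s i → Proper G (setV G s i a)
  setV-proper s i a P free = record { vv = vv ; ve = ve ; ee = Proper.ee P }
    where
    vv : ∀ x y b → Adj G x y → vc (setV G s i a) x ≡ just b → vc (setV G s i a) y ≡ just b → ⊥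
    vv x y b x~y hx hy with setV-view s i a x | setV-view s i a y
    ... | inj₁ (refl , _)  | inj₁ (refl , _)  = adj-irrefl x~y
    ... | inj₁ (refl , e₁) | inj₂ (_ , e₂)    =
      free (subst (_∈ _) (sameColour hx e₁) (neighbour-conflict s x~y (trans (sym e₂) hy)))
    ... | inj₂ (_ , e₁)    | inj₁ (refl , e₂) =
      free (subst (_∈ _) (sameColour hy e₂) (neighbour-conflict s (adj-sym x~y) (trans (sym e₁) hx)))
    ... | inj₂ (_ , e₁)    | inj₂ (_ , e₂)    = Proper.vv P x y b x~y (trans (sym e₁) hx) (trans (sym e₂) hy)
    ve : ∀ x y b → Adj G x y → ec s x y ≡ just b → vc (setV G s i a) x ≡ just b → ⊥
    ve x y b x~y he hx with setV-view s i a x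
    ... | inj₁ (refl , e) = free (subst (_∈ _) (sameColour hx e) (incident-conflict s x~y he))
    ... | inj₂ (_ , e)    = Proper.ve P x y b x~y he (trans (sym e) hx)

  -- The (possibly missing) colours of the two ends of {i , j} and of all edges
  -- at either end (including {i , j} itself, which is harmless).
  coloursAroundEdge : Position → Fin n → Fin n → List (Maybe (Fin k))
  coloursAroundEdge s i j =
    (vc s i ∷ vc s j ∷ []) ++ map (ec s i) (neighbours i) ++ map (ec s j) (neighbours j)

  edgeConflicts : Position → Fin n → Fin n → List (Fin k)
  edgeConflicts s i j = catMaybes (coloursAroundEdge s i j)

  -- The edge {i , j} itself is uncoloured, so each end contributes ≤ Δ - 1 colours.
  |edgeConflicts|<k : ∀ s i j → Symmetric s → Adj G i j → ec s i j ≡ nothing →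
                      length (edgeConflicts s i j) < k
  |edgeConflicts|<k s i j sym-s i~j blank-ij = ≤-trans (s≤s (begin
    length (edgeConflicts s i j)                               ≤⟨ length-catMaybes-++ (vc s i ∷ vc s j ∷ []) (Eᵢ ++ Eⱼ) ⟩
    2 + length (catMaybes (Eᵢ ++ Eⱼ))                          ≡⟨ cong (λ l → 2 + length l) (catMaybes-++ Eᵢ Eⱼ) ⟩
    2 + length (catMaybes Eᵢ ++ catMaybes Eⱼ)                  ≡⟨ cong (2 +_) (length-++ (catMaybes Eᵢ)) ⟩
    2 + (length (catMaybes Eᵢ) + length (catMaybes Eⱼ))        ≡⟨ cong suc (sym (+-suc _ _)) ⟩
    suc (length (catMaybes Eᵢ)) + suc (length (catMaybes Eⱼ)) ≤⟨ +-mono-≤ (length-catMaybes-< Eᵢ blankᵢ)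
                                                                           (length-catMaybes-< Eⱼ blankⱼ) ⟩
    length Eᵢ + length Eⱼ                                      ≡⟨ cong₂ _+_ (length-map (ec s i) (neighbours i)) (length-map (ec s j) (neighbours j)) ⟩
    length (neighbours i) + length (neighbours j)              ∎))
    (twoΔ<k (|neighbours|≤Δ i) (|neighbours|≤Δ j))
    where
    open ≤-Reasoning
    Eᵢ = map (ec s i) (neighbours i)
    Eⱼ = map (ec s j) (neighbours j)
    blankᵢ : nothing ∈ Eᵢ
    blankᵢ = subst (_∈ Eᵢ) blank-ij (∈-map⁺ (ec s i) (∈-neighbours i~j))
    blankⱼ : nothing ∈ Eⱼ
    blankⱼ = subst (_∈ Eⱼ) (trans (sym-s j i) blank-ij) (∈-map⁺ (ec s j) (∈-neighbours (adj-sym i~j)))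

  end-conflict : ∀ s {i j x y b} → OnEdge i j x y → vc s x ≡ just b → b ∈ edgeConflicts s i j
  end-conflict s {i} {j} (inj₁ (refl , _)) e = ∈-catMaybes (coloursAroundEdge s i j) (here (sym e))
  end-conflict s {i} {j} (inj₂ (refl , _)) e = ∈-catMaybes (coloursAroundEdge s i j) (there (here (sym e)))

  adjacent-edge-conflict : ∀ s {i j x y l b} → OnEdge i j x y → Adj G x l → ec s x l ≡ just b →
                           b ∈ edgeConflicts s i j
  adjacent-edge-conflict s {i} {j} (inj₁ (refl , _)) x~l e =
    ∈-catMaybes (coloursAroundEdge s i j)
      (∈-++⁺ʳ (vc s i ∷ vc s j ∷ []) (∈-++⁺ˡ (∈-map-neighbours (ec s i) x~l e)))
  adjacent-edge-conflict s {i} {j} (inj₂ (refl , _)) x~l e =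
    ∈-catMaybes (coloursAroundEdge s i j)
      (∈-++⁺ʳ (vc s i ∷ vc s j ∷ []) (∈-++⁺ʳ (map (ec s i) (neighbours i)) (∈-map-neighbours (ec s j) x~l e)))

  setE-proper : ∀ s i j a → Proper G s → a ∉ edgeConflicts s i j → Proper G (setE G s i j a)
  setE-proper s i j a P free = record { vv = Proper.vv P ; ve = ve ; ee = ee }
    where
    ve : ∀ x y b → Adj G x y → ec (setE G s i j a) x y ≡ just b → vc s x ≡ just b → ⊥
    ve x y b x~y he hx with setE-view s i j a x y
    ... | inj₁ (on , e) = free (subst (_∈ _) (sameColour he e) (end-conflict s on hx))
    ... | inj₂ (_ , e)  = Proper.ve P x y b x~y (trans (sym e) he) hx
    ee : ∀ x y l b → Adj G x y → Adj G x l → y ≢ l →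
         ec (setE G s i j a) x y ≡ just b → ec (setE G s i j a) x l ≡ just b → ⊥
    ee x y l b x~y x~l y≢l hy hl with setE-view s i j a x y | setE-view s i j a x l
    ... | inj₁ (on₁ , _) | inj₁ (on₂ , _) = y≢l (onEdge-functional on₁ on₂)
    ... | inj₁ (on , e₁) | inj₂ (_ , e₂)  =
      free (subst (_∈ _) (sameColour hy e₁) (adjacent-edge-conflict s on x~l (trans (sym e₂) hl)))
    ... | inj₂ (_ , e₁)  | inj₁ (on , e₂) =
      free (subst (_∈ _) (sameColour hl e₂) (adjacent-edge-conflict s on x~y (trans (sym e₁) hy)))
    ... | inj₂ (_ , e₁)  | inj₂ (_ , e₂)  =
      Proper.ee P x y l b x~y x~l y≢l (trans (sym e₁) hy) (trans (sym e₂) hl)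

  Good : Position → Set
  Good s = Proper G s × Symmetric s

  -- Legal moves preserve the invariant: properness is part of legality, and
  -- setV leaves the edge colours untouched.
  good-setV : ∀ {s} i a → Good s → LegalV G s i a → Good (setV G s i a)
  good-setV i a (_ , sym-s) (_ , P) = P , sym-s

  good-setE : ∀ {s} i j a → Good s → LegalE G s i j a → Good (setE G s i j a)
  good-setE {s} i j a (_ , sym-s) (_ , _ , P) = P , setE-symmetric s i j a sym-s

  -- A colour missing from the conflict list is a legal move.
  legalVertexMove : ∀ s i → Proper G s → vc s i ≡ nothing → ∃ λ a → LegalV G s i a
  legalVertexMove s i P blank-i with missingColour (vertexConflicts s i) (|vertexConflicts|<k s i)
  ... | a , free = a , blank-i , setV-proper s i a P free

  legalEdgeMove : ∀ s i j → Good s → Adj G i j → ec s i j ≡ nothing → ∃ λ a → LegalE G s i j a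
  legalEdgeMove s i j (P , sym-s) i~j blank-ij
    with missingColour (edgeConflicts s i j) (|edgeConflicts|<k s i j sym-s i~j blank-ij)
  ... | a , free = a , i~j , blank-ij , setE-proper s i j a P free

  neverStuck : ∀ s → Good s → Complete G s ⊎ SomeLegalMove G s
  neverStuck s good with complete-or-uncoloured s
  ... | inj₁ done                            = inj₁ done
  ... | inj₂ (inj₁ (i , blank-i))            = inj₂ (inj₁ (i , legalVertexMove s i (proj₁ good) blank-i))
  ... | inj₂ (inj₂ (i , j , i~j , blank-ij)) = inj₂ (inj₂ (i , j , legalEdgeMove s i j good i~j blank-ij))

  aliceWins : AliceWins G k
  aliceWins = aliceWinsFrom (initial G) (initialProper , λ _ _ → refl)
    where
    open NeverStuck G Good good-setV good-setE neverStuck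
    initialProper : Proper G (initial G)
    initialProper = record { vv = λ _ _ _ _ () ; ve = λ _ _ _ _ () ; ee = λ _ _ _ _ _ _ _ () }

mainTheorem1 : (n : ℕ) (G : SimpleGraph n) →
    TotalGameChromatic≤ G (suc (2 * maxDegree G))
mainTheorem1 n G = suc (2 * maxDegree G) , ≤-refl , FreeColours.aliceWins G (n<1+n (2 * maxDegree G))
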